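{- Let $P$ be the graph with vertex set $\{u_1,u_2,v_1,v_2,w_1,w_1',w_2,w_2'\}$ and edge set $\{u_1u_2,\ v_1v_2\}\cup\{u_iw_i,\ w_iv_i,\ u_iw_i',\ w_i'v_i : i\in\{1,2\}\}$ (so that for each $i$ there are two internally disjoint paths of length two from $u_i$ to $v_i$), and call $u_1u_2$ and $v_1v_2$ the bones of $P$. For every good $2$-edge-labeling $\lambda$ of $P$, we have $\lambda(u_1u_2)=\lambda(v_1v_2)$.
   Context: An edge-labeling of a graph $G$ is a function $\lambda:E(G)\to\mathbb{R}$; it is a $2$-edge-labeling if it takes at most two distinct values. A path is increasing if the sequence of labels of its edges, read along the path, is non-decreasing. An edge-labeling is good if for every ordered pair of vertices $(x,y)$ there are no two distinct increasing paths from $x$ to $y$. -}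

module Defs where

open import Level using (Level; _⊔_)
open import Data.List using (List; []; _∷_; map)
open import Data.List.Relation.Unary.Unique.Propositional using (Unique)
open import Data.List.Relation.Unary.Linked using (Linked)
open import Data.Product using (Σ; ∃₂; _×_; _,_)
open import Data.Sum using (_⊎_)
open import Relation.Binary.PropositionalEquality using (_≡_)
open import Relation.Binary.Bundles using (TotalOrder)

data V : Set where
  u₁ u₂ v₁ v₂ w₁ w₁' w₂ w₂' : V

data E : Set where
  u₁u₂ v₁v₂ : E
  u₁w₁ w₁v₁ u₁w₁' w₁'v₁ : E
  u₂w₂ w₂v₂ u₂w₂' w₂'v₂ : E

ends : E → V × V
ends u₁u₂  = u₁ , u₂
ends v₁v₂  = v₁ , v₂
ends u₁w₁  = u₁ , w₁
ends w₁v₁  = w₁ , v₁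
ends u₁w₁' = u₁ , w₁'
ends w₁'v₁ = w₁' , v₁
ends u₂w₂  = u₂ , w₂
ends w₂v₂  = w₂ , v₂
ends u₂w₂' = u₂ , w₂'
ends w₂'v₂ = w₂' , v₂

data Joins (e : E) (x y : V) : Set where
  fwd : ends e ≡ (x , y) → Joins e x y
  bwd : ends e ≡ (y , x) → Joins e x y

data Walk : V → V → Set where
  []   : ∀ {x} → Walk x x
  step : ∀ {x y z} (e : E) → Joins e x y → Walk y z → Walk x z

vertices : ∀ {x y} → Walk x y → List V
vertices {x} []            = x ∷ []
vertices {x} (step e j w)  = x ∷ vertices w

edges : ∀ {x y} → Walk x y → List E
edges []           = []
edges (step e j w) = e ∷ edges w

IsPath : ∀ {x y} → Walk x y → Set
IsPath w = Unique (vertices w)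

module _ {c ℓ₁ ℓ₂ : Level} (O : TotalOrder c ℓ₁ ℓ₂) where
  open TotalOrder O renaming (Carrier to A)

  Is2Labeling : (E → A) → Set (c ⊔ ℓ₁)
  Is2Labeling λ' = ∃₂ λ a b → ∀ e → (λ' e ≈ a) ⊎ (λ' e ≈ b)

  Increasing : (E → A) → ∀ {x y} → Walk x y → Set (c ⊔ ℓ₂)
  Increasing λ' w = Linked _≤_ (map λ' (edges w))

  Good : (E → A) → Set (c ⊔ ℓ₂)
  Good λ' = ∀ {x y} (p q : Walk x y) → IsPath p → IsPath q →
            Increasing λ' p → Increasing λ' q → p ≡ q

{-# OPTIONS --safe #-}
module Submission where

-- In a 2-labeling with values a ≤ b, two bones with different labels are a
-- minimal and a maximal edge. Goodness forces each of the two diamonds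
-- u_i–{w_i, w_i'}–v_i to contain an increasing route in either direction:
-- otherwise both reversed routes would be increasing. Prefixing a route of one
-- diamond with the minimal bone, and suffixing a route of the other diamond
-- with the maximal bone, gives two distinct increasing paths with the same ends.

open import Defs
open import Relation.Binary.Bundles using (TotalOrder)
open import Data.Bool using (Bool; true; false)
open import Data.Product using (∃; _×_; _,_)
open import Data.Sum using (_⊎_; inj₁; inj₂; swap)
open import Data.Empty using (⊥; ⊥-elim)
open import Function using (_∘_)
open import Data.List using ([]; _∷_)
open import Data.List.Properties using (∷-injectiveˡ; ∷-injectiveʳ)
open import Data.List.Relation.Unary.AllPairs using ([]; _∷_)
open import Data.List.Relation.Unary.All using ([]; _∷_)
open import Data.List.Relation.Unary.Linked using ([-]; _∷_; head)
open import Relation.Binary.PropositionalEquality using (_≢_; refl; cong; ≢-sym)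

joins-sym : ∀ {e x y} → Joins e x y → Joins e y x
joins-sym (fwd p) = bwd p
joins-sym (bwd p) = fwd p

edge : ∀ {x y} (e : E) → Joins e x y → Walk x y
edge e j = step e j []

infixr 5 _++ᵂ_

_++ᵂ_ : ∀ {x y z} → Walk x y → Walk y z → Walk x z
[]         ++ᵂ q = q
step e j p ++ᵂ q = step e j (p ++ᵂ q)

record Diamond (x y : V) : Set where
  field
    mid           : Bool → V
    first last    : Bool → E
    first-joins   : ∀ r → Joins (first r) x (mid r)
    last-joins    : ∀ r → Joins (last r) (mid r) y
    ends-distinct : x ≢ y
    source≢mid    : ∀ r → x ≢ mid r
    mid≢target    : ∀ r → mid r ≢ y
    mids-distinct : mid true ≢ mid false

  route : Bool → Walk x y
  route r = edge (first r) (first-joins r) ++ᵂ edge (last r) (last-joins r)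

  route-isPath : ∀ r → IsPath (route r)
  route-isPath r = (source≢mid r ∷ ends-distinct ∷ []) ∷ (mid≢target r ∷ []) ∷ [] ∷ []

  routes-distinct : route true ≢ route false
  routes-distinct = mids-distinct ∘ ∷-injectiveˡ ∘ ∷-injectiveʳ ∘ cong vertices

reverse : ∀ {x y} → Diamond x y → Diamond y x
reverse D = record
  { mid           = mid
  ; first         = last
  ; last          = first
  ; first-joins   = joins-sym ∘ last-joins
  ; last-joins    = joins-sym ∘ first-joins
  ; ends-distinct = ≢-sym ends-distinct
  ; source≢mid    = ≢-sym ∘ mid≢target
  ; mid≢target    = ≢-sym ∘ source≢mid
  ; mids-distinct = mids-distinct
  }
  where open Diamond D

diamond₁ : Diamond u₁ v₁
diamond₁ = record
  { mid           = λ { true → w₁    ; false → w₁' }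
  ; first         = λ { true → u₁w₁  ; false → u₁w₁' }
  ; last          = λ { true → w₁v₁  ; false → w₁'v₁ }
  ; first-joins   = λ { true → fwd refl ; false → fwd refl }
  ; last-joins    = λ { true → fwd refl ; false → fwd refl }
  ; ends-distinct = λ ()
  ; source≢mid    = λ { true () ; false () }
  ; mid≢target    = λ { true () ; false () }
  ; mids-distinct = λ ()
  }

diamond₂ : Diamond u₂ v₂
diamond₂ = record
  { mid           = λ { true → w₂    ; false → w₂' }
  ; first         = λ { true → u₂w₂  ; false → u₂w₂' }
  ; last          = λ { true → w₂v₂  ; false → w₂'v₂ }
  ; first-joins   = λ { true → fwd refl ; false → fwd refl }
  ; last-joins    = λ { true → fwd refl ; false → fwd refl }
  ; ends-distinct = λ ()
  ; source≢mid    = λ { true () ; false () }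
  ; mid≢target    = λ { true () ; false () }
  ; mids-distinct = λ ()
  }

module _ {c ℓ₁ ℓ₂} (O : TotalOrder c ℓ₁ ℓ₂) (λ' : E → TotalOrder.Carrier O) where
  open TotalOrder O renaming (Carrier to A) hiding (refl)
  open Diamond using (route; first; last)

  IsMinimal IsMaximal : E → Set ℓ₂
  IsMinimal e = ∀ f → λ' e ≤ λ' f
  IsMaximal e = ∀ f → λ' f ≤ λ' e

  module _ {a b : A} (a≤b : a ≤ b) (two : ∀ g → λ' g ≈ a ⊎ λ' g ≈ b) where

    ≈-lower⇒minimal : ∀ {e} → λ' e ≈ a → IsMinimal e
    ≈-lower⇒minimal e≈a g with two g
    ... | inj₁ g≈a = reflexive (Eq.trans e≈a (Eq.sym g≈a))
    ... | inj₂ g≈b = trans (reflexive e≈a) (trans a≤b (reflexive (Eq.sym g≈b)))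

    ≈-upper⇒maximal : ∀ {e} → λ' e ≈ b → IsMaximal e
    ≈-upper⇒maximal e≈b g with two g
    ... | inj₁ g≈a = trans (reflexive g≈a) (trans a≤b (reflexive (Eq.sym e≈b)))
    ... | inj₂ g≈b = reflexive (Eq.trans g≈b (Eq.sym e≈b))

    ordered-equal-or-extremal : ∀ e f →
      λ' e ≈ λ' f ⊎ (IsMinimal e × IsMaximal f) ⊎ (IsMaximal e × IsMinimal f)
    ordered-equal-or-extremal e f with two e | two f
    ... | inj₁ e≈a | inj₁ f≈a = inj₁ (Eq.trans e≈a (Eq.sym f≈a))
    ... | inj₂ e≈b | inj₂ f≈b = inj₁ (Eq.trans e≈b (Eq.sym f≈b))
    ... | inj₁ e≈a | inj₂ f≈b = inj₂ (inj₁ (≈-lower⇒minimal e≈a , ≈-upper⇒maximal f≈b))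
    ... | inj₂ e≈b | inj₁ f≈a = inj₂ (inj₂ (≈-upper⇒maximal e≈b , ≈-lower⇒minimal f≈a))

  2-labeling-equal-or-extremal : Is2Labeling O λ' → ∀ e f →
    λ' e ≈ λ' f ⊎ (IsMinimal e × IsMaximal f) ⊎ (IsMaximal e × IsMinimal f)
  2-labeling-equal-or-extremal (a , b , two) with total a b
  ... | inj₁ a≤b = ordered-equal-or-extremal a≤b two
  ... | inj₂ b≤a = ordered-equal-or-extremal b≤a (swap ∘ two)

  module _ (good : Good O λ') where

    diamond-has-increasing-route : ∀ {x y} (D : Diamond x y) → ∃ λ r → Increasing O λ' (route D r)
    diamond-has-increasing-route D
      with total (λ' (first D true)) (λ' (last D true))
         | total (λ' (first D false)) (λ' (last D false))
    ... | inj₁ ≤₁ | _       = true , ≤₁ ∷ [-]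
    ... | inj₂ _  | inj₁ ≤₂ = false , ≤₂ ∷ [-]
    ... | inj₂ ≥₁ | inj₂ ≥₂ =
      ⊥-elim (routes-distinct (good _ _ (route-isPath true) (route-isPath false) (≥₁ ∷ [-]) (≥₂ ∷ [-])))
      where open Diamond (reverse D)

    ¬minimal-bone-before-maximal-bone : ∀ {x y x' y' e f} (D : Diamond x y) (D' : Diamond x' y')
      (j : Joins e x' x) (k : Joins f y' y) →
      (∀ r → IsPath (edge e j ++ᵂ route D r)) →
      (∀ s → IsPath (route D' s ++ᵂ edge f k)) →
      (∀ r s → edge e j ++ᵂ route D r ≢ route D' s ++ᵂ edge f k) →
      IsMinimal e → IsMaximal f → ⊥
    ¬minimal-bone-before-maximal-bone D D' j k isPathˡ isPathʳ distinct min max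
      with diamond-has-increasing-route D | diamond-has-increasing-route D'
    ... | r , ↗r | s , ↗s =
      distinct r s (good _ _ (isPathˡ r) (isPathʳ s) (min _ ∷ ↗r) (head ↗s ∷ max _ ∷ [-]))

    ¬u₁u₂-minimal-v₁v₂-maximal : IsMinimal u₁u₂ → IsMaximal v₁v₂ → ⊥
    ¬u₁u₂-minimal-v₁v₂-maximal =
      ¬minimal-bone-before-maximal-bone diamond₁ diamond₂ (bwd refl) (bwd refl)
        (λ { true  → ((λ ()) ∷ (λ ()) ∷ (λ ()) ∷ []) ∷ ((λ ()) ∷ (λ ()) ∷ []) ∷ ((λ ()) ∷ []) ∷ [] ∷ []
           ; false → ((λ ()) ∷ (λ ()) ∷ (λ ()) ∷ []) ∷ ((λ ()) ∷ (λ ()) ∷ []) ∷ ((λ ()) ∷ []) ∷ [] ∷ [] })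
        (λ { true  → ((λ ()) ∷ (λ ()) ∷ (λ ()) ∷ []) ∷ ((λ ()) ∷ (λ ()) ∷ []) ∷ ((λ ()) ∷ []) ∷ [] ∷ []
           ; false → ((λ ()) ∷ (λ ()) ∷ (λ ()) ∷ []) ∷ ((λ ()) ∷ (λ ()) ∷ []) ∷ ((λ ()) ∷ []) ∷ [] ∷ [] })
        (λ { _ true () ; _ false () })

    ¬u₁u₂-maximal-v₁v₂-minimal : IsMaximal u₁u₂ → IsMinimal v₁v₂ → ⊥
    ¬u₁u₂-maximal-v₁v₂-minimal max min =
      ¬minimal-bone-before-maximal-bone (reverse diamond₂) (reverse diamond₁) (fwd refl) (fwd refl)
        (λ { true  → ((λ ()) ∷ (λ ()) ∷ (λ ()) ∷ []) ∷ ((λ ()) ∷ (λ ()) ∷ []) ∷ ((λ ()) ∷ []) ∷ [] ∷ []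
           ; false → ((λ ()) ∷ (λ ()) ∷ (λ ()) ∷ []) ∷ ((λ ()) ∷ (λ ()) ∷ []) ∷ ((λ ()) ∷ []) ∷ [] ∷ [] })
        (λ { true  → ((λ ()) ∷ (λ ()) ∷ (λ ()) ∷ []) ∷ ((λ ()) ∷ (λ ()) ∷ []) ∷ ((λ ()) ∷ []) ∷ [] ∷ []
           ; false → ((λ ()) ∷ (λ ()) ∷ (λ ()) ∷ []) ∷ ((λ ()) ∷ (λ ()) ∷ []) ∷ ((λ ()) ∷ []) ∷ [] ∷ [] })
        (λ { _ true () ; _ false () })
        min max

mainTheorem10 : ∀ {c ℓ₁ ℓ₂} (O : TotalOrder c ℓ₁ ℓ₂) (λ' : E → TotalOrder.Carrier O) →
    Is2Labeling O λ' → Good O λ' → TotalOrder._≈_ O (λ' u₁u₂) (λ' v₁v₂)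
mainTheorem10 O λ' two good with 2-labeling-equal-or-extremal O λ' two u₁u₂ v₁v₂
... | inj₁ equal                  = equal
... | inj₂ (inj₁ (min₁₂ , max₁₂)) = ⊥-elim (¬u₁u₂-minimal-v₁v₂-maximal O λ' good min₁₂ max₁₂)
... | inj₂ (inj₂ (max₁₂ , min₁₂)) = ⊥-elim (¬u₁u₂-maximal-v₁v₂-minimal O λ' good max₁₂ min₁₂)
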